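{- Let $(Q,\mathcal{B})$ be a uniform nested SQS$(v)$ in which there are exactly $\frac{v}{2}\left(\frac{v}{2}-1\right)$ ND-pairs. Then $v \equiv 4 \pmod 6$ and the multiplicity of each ND-pair is $\frac{v-1}{3}$.
   Context: A Steiner quadruple system SQS$(v)$ is a pair $(Q,\mathcal{B})$ where $Q$ is a set of $v$ points and $\mathcal{B}$ is a collection of 4-subsets of $Q$ (blocks) such that every 3-subset of $Q$ is contained in exactly one block. (An SQS$(v)$ exists if and only if $v\ge 4$ and $v\equiv 2$ or $4 \pmod 6$.) A nested SQS$(v)$ is an SQS$(v)$ together with a partition of each block into two 2-subsets (pairs). A pair of points is an ND-pair if it is one of the two pairs in the partition of at least one block; the multiplicity of a pair is the number of blocks whose partition contains that pair. A nested SQS is uniform if all its ND-pairs have the same multiplicity. -}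

module Defs where

open import Data.Nat using (ℕ; _≤_; _≥_)
open import Data.Fin using (Fin; _<_; _≟_)
open import Data.Bool using (Bool; _∧_; _∨_; true)
open import Data.List using (List; []; _∷_; length; filter; allFin; concatMap; map)
open import Data.Product using (_×_; _,_; Σ; ∃)
open import Relation.Nullary using (¬_)
open import Relation.Nullary.Decidable using (⌊_⌋)
open import Relation.Binary.PropositionalEquality using (_≡_)
open import Data.Bool using (T)

-- A nested block on the point set Fin v: a 4-subset {a,b,c,d} of distinct
-- points, together with its partition into the two pairs {a,b} and {c,d}.
record NBlock (v : ℕ) : Set where
  constructor nblock
  field
    a b c d : Fin v
    a≢b : ¬ a ≡ b
    a≢c : ¬ a ≡ c
    a≢d : ¬ a ≡ d
    b≢c : ¬ b ≡ c
    b≢d : ¬ b ≡ d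
    c≢d : ¬ c ≡ d
open NBlock public

_==_ : ∀ {v} → Fin v → Fin v → Bool
x == y = ⌊ x ≟ y ⌋

_∈B_ : ∀ {v} → Fin v → NBlock v → Bool
x ∈B B = (x == a B) ∨ (x == b B) ∨ (x == c B) ∨ (x == d B)

tripleIn : ∀ {v} → Fin v → Fin v → Fin v → NBlock v → Bool
tripleIn x y z B = (x ∈B B) ∧ (y ∈B B) ∧ (z ∈B B)

samePair : ∀ {v} → Fin v → Fin v → Fin v → Fin v → Bool
samePair x y p q = ((x == p) ∧ (y == q)) ∨ ((x == q) ∧ (y == p))

pairIn : ∀ {v} → Fin v → Fin v → NBlock v → Bool
pairIn x y B = samePair x y (a B) (b B) ∨ samePair x y (c B) (d B)

tripleCount : ∀ {v} → List (NBlock v) → Fin v → Fin v → Fin v → ℕ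
tripleCount 𝓑 x y z = length (filter (λ B → T? (tripleIn x y z B)) 𝓑)
  where
  open import Data.Bool.Properties using () renaming (T? to T?)

IsNestedSQS : (v : ℕ) → List (NBlock v) → Set
IsNestedSQS v 𝓑 =
  (4 ≤ v) ×
  (∀ (x y z : Fin v) → x < y → y < z → tripleCount 𝓑 x y z ≡ 1)

multiplicity : ∀ {v} → List (NBlock v) → Fin v → Fin v → ℕ
multiplicity 𝓑 x y = length (filter (λ B → T? (pairIn x y B)) 𝓑)
  where
  open import Data.Bool.Properties using () renaming (T? to T?)

IsNDPair : ∀ {v} → List (NBlock v) → Fin v → Fin v → Set
IsNDPair 𝓑 x y = (x < y) × (multiplicity 𝓑 x y ≥ 1)

allPairs : (v : ℕ) → List (Fin v × Fin v)
allPairs v = filter (λ p → Data.Fin._<?_ (Data.Product.proj₁ p) (Data.Product.proj₂ p))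
                    (concatMap (λ x → map (λ y → (x , y)) (allFin v)) (allFin v))
  where
  import Data.Fin
  import Data.Product

numNDPairs : ∀ {v} → List (NBlock v) → ℕ
numNDPairs {v} 𝓑 =
  length (filter (λ p → Data.Nat._≤?_ 1 (multiplicity 𝓑 (Data.Product.proj₁ p) (Data.Product.proj₂ p)))
                 (allPairs v))
  where
  import Data.Nat
  import Data.Product

IsUniform : ∀ {v} → List (NBlock v) → Set
IsUniform {v} 𝓑 = ∃ λ (m : ℕ) → ∀ (x y : Fin v) → IsNDPair 𝓑 x y → multiplicity 𝓑 x y ≡ m

{-# OPTIONS --safe #-}
-- Double counting.  Every 3-subset lies in exactly one block and every block contains four
-- of them, so C(v,3) = 4|𝓑|.  Every block contributes its two ND-pairs, so the
-- multiplicities add up to 2|𝓑|, and by uniformity this sum is m·N with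
-- N = (v/2)(v/2−1) ND-pairs.  Hence C(v,3) = 2mN.  For odd v = 2k+1 this says
-- (2k+1)(2k−1) = 6m(k−1), odd = even.  For even v = 2k it says 2k−1 = 3m, so
-- m = (v−1)/3; as v = 3m+1 is even, m is odd and v ≡ 4 (mod 6).
module Submission where

open import Defs
open import Data.Nat using (ℕ; zero; suc; _+_; _*_; _∸_; _≤_; _≤?_; z≤n; s≤s)
open import Data.Nat.DivMod using (_/_; _%_; m*n/n≡m; [m+kn]%n≡m%n; +-distrib-/-∣ʳ)
open import Data.Nat.Divisibility using (divides-refl)
open import Data.Nat.Properties
  using (+-identityʳ; +-assoc; *-identityʳ; *-zeroʳ; *-suc; *-assoc; *-comm; *-distribˡ-+; *-distribʳ-+;
         *-cancelˡ-≡; even≢odd)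
open import Data.Nat.Combinatorics using (_C_; nC1≡n; nCk+nC[k+1]≡[n+1]C[k+1])
open import Data.Nat.Tactic.RingSolver using (solve-∀)
open import Data.Bool using (Bool; true; false; _∧_; _∨_; T)
open import Data.Bool.Properties using (T-∧; T-∨)
open import Data.Empty using (⊥; ⊥-elim)
open import Data.Fin using (Fin; zero; suc; _<_; _<?_)
open import Data.Fin.Properties using (_≟_; <-cmp)
open import Data.List using (List; []; _∷_; _++_; length; map; filter; concatMap; allFin)
open import Data.List.Properties using (map-tabulate; length-tabulate)
open import Data.List.Relation.Unary.All as All using (All; []; _∷_)
open import Data.List.Relation.Unary.All.Properties using (all-filter; map⁺; ++⁺)
open import Data.List.Relation.Unary.AllPairs using (AllPairs; []; _∷_)
open import Data.List.Relation.Unary.AllPairs.Properties using (tabulate⁺-<)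
open import Data.Product using (_×_; _,_; proj₁; proj₂; curry; uncurry′)
open import Data.Sum using (_⊎_; inj₁; inj₂; [_,_])
open import Function using (_∘_; id; Equivalence)
open import Relation.Binary using (tri<; tri≈; tri>)
open import Relation.Binary.PropositionalEquality using (_≡_; _≢_; refl; sym; trans; cong; cong₂; module ≡-Reasoning)
open import Relation.Nullary using (¬_; does; yes; no)
open import Relation.Nullary.Decidable using (T?; toWitness; dec-true; dec-false)
open import Relation.Unary using (Decidable)

open ≡-Reasoning
open Equivalence using (to)

private variable
  A B : Set

∑ : List A → (A → ℕ) → ℕ
∑ []       f = 0
∑ (x ∷ xs) f = f x + ∑ xs f

infix 6.5 ∑
syntax ∑ xs (λ x → e) = ∑[ x ∈ xs ] e

∑-cong : ∀ {f g : A → ℕ} xs → (∀ x → f x ≡ g x) → ∑ xs f ≡ ∑ xs g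
∑-cong []       f≗g = refl
∑-cong (x ∷ xs) f≗g = cong₂ _+_ (f≗g x) (∑-cong xs f≗g)

∑-cong-All : ∀ {f g : A → ℕ} {xs} → All (λ x → f x ≡ g x) xs → ∑ xs f ≡ ∑ xs g
∑-cong-All []         = refl
∑-cong-All (eq ∷ eqs) = cong₂ _+_ eq (∑-cong-All eqs)

∑-const : ∀ c (xs : List A) → ∑[ _ ∈ xs ] c ≡ c * length xs
∑-const c []       = sym (*-zeroʳ c)
∑-const c (x ∷ xs) = trans (cong (c +_) (∑-const c xs)) (sym (*-suc c (length xs)))

∑-1 : ∀ (xs : List A) → ∑[ _ ∈ xs ] 1 ≡ length xs
∑-1 []       = refl
∑-1 (x ∷ xs) = cong suc (∑-1 xs)

∑-+ : ∀ xs (f g : A → ℕ) → ∑[ x ∈ xs ] (f x + g x) ≡ ∑ xs f + ∑ xs g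
∑-+ []       f g = refl
∑-+ (x ∷ xs) f g = trans (cong (f x + g x +_) (∑-+ xs f g)) (interchange (f x) (g x) _ _)
  where
  interchange : ∀ a b c d → a + b + (c + d) ≡ a + c + (b + d)
  interchange = solve-∀

∑-*ˡ : ∀ c xs (f : A → ℕ) → ∑[ x ∈ xs ] (c * f x) ≡ c * ∑ xs f
∑-*ˡ c []       f = sym (*-zeroʳ c)
∑-*ˡ c (x ∷ xs) f = trans (cong (c * f x +_) (∑-*ˡ c xs f)) (sym (*-distribˡ-+ c (f x) _))

∑-++ : ∀ xs ys (f : A → ℕ) → ∑ (xs ++ ys) f ≡ ∑ xs f + ∑ ys f
∑-++ []       ys f = refl
∑-++ (x ∷ xs) ys f = trans (cong (f x +_) (∑-++ xs ys f)) (sym (+-assoc (f x) _ _))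

∑-map : ∀ (g : A → B) xs (f : B → ℕ) → ∑ (map g xs) f ≡ ∑[ x ∈ xs ] f (g x)
∑-map g []       f = refl
∑-map g (x ∷ xs) f = cong (f (g x) +_) (∑-map g xs f)

∑-concatMap : ∀ (g : A → List B) xs (f : B → ℕ) → ∑ (concatMap g xs) f ≡ ∑[ x ∈ xs ] ∑ (g x) f
∑-concatMap g []       f = refl
∑-concatMap g (x ∷ xs) f = trans (∑-++ (g x) (concatMap g xs) f) (cong (∑ (g x) f +_) (∑-concatMap g xs f))

∑-swap : ∀ xs (ys : List B) (f : A → B → ℕ) →
         ∑[ x ∈ xs ] ∑[ y ∈ ys ] f x y ≡ ∑[ y ∈ ys ] ∑[ x ∈ xs ] f x y
∑-swap xs []       f = ∑-const 0 xs
∑-swap xs (y ∷ ys) f = trans (∑-+ xs (λ x → f x y) (λ x → ∑[ y ∈ ys ] f x y))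
                             (cong (∑[ x ∈ xs ] f x y +_) (∑-swap xs ys f))

⟦_⟧ : Bool → ℕ
⟦ true  ⟧ = 1
⟦ false ⟧ = 0

⟦∧⟧ : ∀ b c → ⟦ b ∧ c ⟧ ≡ ⟦ b ⟧ * ⟦ c ⟧
⟦∧⟧ true  c = sym (+-identityʳ ⟦ c ⟧)
⟦∧⟧ false c = refl

⟦∨⟧ : ∀ b c → (T b → T c → ⊥) → ⟦ b ∨ c ⟧ ≡ ⟦ b ⟧ + ⟦ c ⟧
⟦∨⟧ true  true  disjoint = ⊥-elim (disjoint _ _)
⟦∨⟧ true  false _        = refl
⟦∨⟧ false c     _        = refl

∑-⟦∨⟧ : ∀ (P Q : A → Bool) xs → (∀ x → T (P x) → T (Q x) → ⊥) →
        ∑[ x ∈ xs ] ⟦ P x ∨ Q x ⟧ ≡ ∑[ x ∈ xs ] ⟦ P x ⟧ + ∑[ x ∈ xs ] ⟦ Q x ⟧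
∑-⟦∨⟧ P Q xs disjoint = trans (∑-cong xs (λ x → ⟦∨⟧ (P x) (Q x) (disjoint x))) (∑-+ xs _ _)

length-filter≡∑ : ∀ {P : A → Set} (P? : Decidable P) xs →
                  length (filter P? xs) ≡ ∑[ x ∈ xs ] ⟦ does (P? x) ⟧
length-filter≡∑ P? []       = refl
length-filter≡∑ P? (x ∷ xs) with does (P? x)
... | true  = cong suc (length-filter≡∑ P? xs)
... | false = length-filter≡∑ P? xs

∑-filter : ∀ {P : A → Set} (P? : Decidable P) xs (f : A → ℕ) →
           ∑ (filter P? xs) f ≡ ∑[ x ∈ xs ] ⟦ does (P? x) ⟧ * f x
∑-filter P? []       f = refl
∑-filter P? (x ∷ xs) f with does (P? x)
... | true  = cong₂ _+_ (sym (+-identityʳ (f x))) (∑-filter P? xs f)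
... | false = ∑-filter P? xs f

double-counting : ∀ (R : A → B → Bool) xs ys →
                  ∑[ x ∈ xs ] length (filter (λ y → T? (R x y)) ys) ≡ ∑[ y ∈ ys ] ∑[ x ∈ xs ] ⟦ R x y ⟧
double-counting R xs ys =
  trans (∑-cong xs (λ x → length-filter≡∑ (λ y → T? (R x y)) ys)) (∑-swap xs ys (λ x y → ⟦ R x y ⟧))

∑-uniform-on-support : ∀ (f : A → ℕ) m xs → All (λ x → 1 ≤ f x → f x ≡ m) xs →
                       ∑ xs f ≡ m * length (filter (λ x → 1 ≤? f x) xs)
∑-uniform-on-support f m xs uniform = begin
  ∑ xs f                                ≡⟨ ∑-cong-All (All.map (λ {x} → on-support (f x)) uniform) ⟩
  ∑[ x ∈ xs ] (m * ⟦ does (1 ≤? f x) ⟧) ≡⟨ ∑-*ˡ m xs _ ⟩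
  m * (∑[ x ∈ xs ] ⟦ does (1 ≤? f x) ⟧) ≡⟨ cong (m *_) (length-filter≡∑ (λ x → 1 ≤? f x) xs) ⟨
  m * length (filter (λ x → 1 ≤? f x) xs) ∎
  where
  on-support : ∀ n → (1 ≤ n → n ≡ m) → n ≡ m * ⟦ does (1 ≤? n) ⟧
  on-support zero    _          = sym (*-zeroʳ m)
  on-support (suc n) positive⇒m = trans (positive⇒m (s≤s z≤n)) (sym (*-identityʳ m))

uncurry₃ : ∀ {ℓ} {D : Set ℓ} → (A → A → A → D) → A × A × A → D
uncurry₃ f (x , y , z) = f x y z

pairs : List A → List (A × A)
pairs []       = []
pairs (x ∷ xs) = map (x ,_) xs ++ pairs xs

triples : List A → List (A × A × A)
triples []       = []
triples (x ∷ xs) = map (x ,_) (pairs xs) ++ triples xs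

∑-pairs-∧ : ∀ (S : A → Bool) xs →
            ∑ (pairs xs) (uncurry′ λ x y → ⟦ S x ∧ S y ⟧) ≡ (∑[ x ∈ xs ] ⟦ S x ⟧) C 2
∑-pairs-∧ S []       = refl
∑-pairs-∧ {A = A} S (x ∷ xs) = begin
  ∑ (map (x ,_) xs ++ pairs xs) F                ≡⟨ ∑-++ (map (x ,_) xs) (pairs xs) F ⟩
  ∑ (map (x ,_) xs) F + ∑ (pairs xs) F           ≡⟨ cong₂ _+_ (∑-map (x ,_) xs F) (∑-pairs-∧ S xs) ⟩
  ∑[ y ∈ xs ] ⟦ S x ∧ S y ⟧ + k C 2              ≡⟨ pascal (S x) ⟩
  (⟦ S x ⟧ + k) C 2                              ∎
  where
  F : A × A → ℕ
  F = uncurry′ λ x y → ⟦ S x ∧ S y ⟧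
  k : ℕ
  k = ∑[ y ∈ xs ] ⟦ S y ⟧
  pascal : ∀ b → ∑[ y ∈ xs ] ⟦ b ∧ S y ⟧ + k C 2 ≡ (⟦ b ⟧ + k) C 2
  pascal true  = trans (cong (_+ k C 2) (sym (nC1≡n k))) (nCk+nC[k+1]≡[n+1]C[k+1] k 1)
  pascal false = cong (_+ k C 2) (∑-const 0 xs)

∑-triples-∧ : ∀ (S : A → Bool) xs →
              ∑ (triples xs) (uncurry₃ λ x y z → ⟦ S x ∧ S y ∧ S z ⟧) ≡ (∑[ x ∈ xs ] ⟦ S x ⟧) C 3
∑-triples-∧ S []       = refl
∑-triples-∧ {A = A} S (x ∷ xs) = begin
  ∑ (map (x ,_) (pairs xs) ++ triples xs) F      ≡⟨ ∑-++ (map (x ,_) (pairs xs)) (triples xs) F ⟩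
  ∑ (map (x ,_) (pairs xs)) F + ∑ (triples xs) F ≡⟨ cong₂ _+_ (∑-map (x ,_) (pairs xs) F) (∑-triples-∧ S xs) ⟩
  ∑[ p ∈ pairs xs ] F (x , p) + k C 3            ≡⟨ pascal (S x) ⟩
  (⟦ S x ⟧ + k) C 3                              ∎
  where
  F : A × A × A → ℕ
  F = uncurry₃ λ x y z → ⟦ S x ∧ S y ∧ S z ⟧
  k : ℕ
  k = ∑[ y ∈ xs ] ⟦ S y ⟧
  pascal : ∀ b → ∑[ p ∈ pairs xs ] ⟦ b ∧ S (proj₁ p) ∧ S (proj₂ p) ⟧ + k C 3 ≡ (⟦ b ⟧ + k) C 3
  pascal true  = trans (cong (_+ k C 3) (∑-pairs-∧ S xs)) (nCk+nC[k+1]≡[n+1]C[k+1] k 2)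
  pascal false = cong (_+ k C 3) (∑-const 0 (pairs xs))

pairs⁺ : ∀ {P : A → Set} {R : A → A → Set} {xs} →
         All P xs → AllPairs R xs → All (uncurry′ λ x y → P x × R x y) (pairs xs)
pairs⁺ []         []         = []
pairs⁺ (px ∷ pxs) (rx ∷ rxs) = ++⁺ (map⁺ (All.map (px ,_) rx)) (pairs⁺ pxs rxs)

triples⁺ : ∀ {R : A → A → Set} {xs} →
           AllPairs R xs → All (uncurry₃ λ x y z → R x y × R y z) (triples xs)
triples⁺ []         = []
triples⁺ (rx ∷ rxs) = ++⁺ (map⁺ (pairs⁺ rx rxs)) (triples⁺ rxs)

allFin-sorted : ∀ n → AllPairs _<_ (allFin n)
allFin-sorted n = tabulate⁺-< id

==-suc : ∀ {n} (x y : Fin n) → (suc x == suc y) ≡ (x == y)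
==-suc x y with x ≟ y
... | yes _ = refl
... | no  _ = refl

==-apart : ∀ {n} {x p q : Fin n} → ¬ p ≡ q → T (x == p) → T (x == q) → ⊥
==-apart {x = x} {p} {q} p≢q x≡p x≡q =
  p≢q (trans (sym (toWitness {a? = x ≟ p} x≡p)) (toWitness {a? = x ≟ q} x≡q))

∑-allFin-suc : ∀ {n} (f : Fin (suc n) → ℕ) → ∑ (allFin (suc n)) f ≡ f zero + ∑[ x ∈ allFin n ] f (suc x)
∑-allFin-suc {n} f =
  cong (f zero +_) (trans (cong (λ xs → ∑ xs f) (sym (map-tabulate id suc))) (∑-map suc (allFin n) f))

∑-delta : ∀ {n} (q : Fin n) (g : Fin n → ℕ) → ∑[ x ∈ allFin n ] ⟦ x == q ⟧ * g x ≡ g q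
∑-delta {suc n} zero g = begin
  ∑[ x ∈ allFin (suc n) ] ⟦ x == zero ⟧ * g x  ≡⟨ ∑-allFin-suc (λ x → ⟦ x == zero ⟧ * g x) ⟩
  g zero + 0 + ∑[ _ ∈ allFin n ] 0            ≡⟨ cong (g zero + 0 +_) (∑-const 0 (allFin n)) ⟩
  g zero + 0 + 0                              ≡⟨ +-identityʳ _ ⟩
  g zero + 0                                  ≡⟨ +-identityʳ _ ⟩
  g zero                                      ∎
∑-delta {suc n} (suc q) g = begin
  ∑[ x ∈ allFin (suc n) ] ⟦ x == suc q ⟧ * g x      ≡⟨ ∑-allFin-suc (λ x → ⟦ x == suc q ⟧ * g x) ⟩
  ∑[ x ∈ allFin n ] ⟦ suc x == suc q ⟧ * g (suc x)  ≡⟨ ∑-cong (allFin n) (λ x → cong (λ b → ⟦ b ⟧ * g (suc x)) (==-suc x q)) ⟩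
  ∑[ x ∈ allFin n ] ⟦ x == q ⟧ * g (suc x)          ≡⟨ ∑-delta q (g ∘ suc) ⟩
  g (suc q)                                         ∎

∑-⟦==⟧ : ∀ {n} (q : Fin n) → ∑[ x ∈ allFin n ] ⟦ x == q ⟧ ≡ 1
∑-⟦==⟧ {n} q = trans (∑-cong (allFin n) (λ x → sym (*-identityʳ ⟦ x == q ⟧))) (∑-delta q (λ _ → 1))

⟦p<q⟧+⟦q<p⟧≡1 : ∀ {n} {p q : Fin n} → ¬ p ≡ q → ⟦ does (p <? q) ⟧ + ⟦ does (q <? p) ⟧ ≡ 1
⟦p<q⟧+⟦q<p⟧≡1 {p = p} {q} p≢q with <-cmp p q
... | tri< p<q _ q≮p rewrite dec-true (p <? q) p<q | dec-false (q <? p) q≮p = refl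
... | tri≈ _ p≡q _   = ⊥-elim (p≢q p≡q)
... | tri> p≮q _ q<p rewrite dec-false (p <? q) p≮q | dec-true (q <? p) q<p = refl

∑-allPairs : ∀ {v} (f : Fin v → Fin v → ℕ) →
             ∑ (allPairs v) (uncurry′ f) ≡ ∑[ x ∈ allFin v ] ∑[ y ∈ allFin v ] ⟦ does (x <? y) ⟧ * f x y
∑-allPairs {v} f = begin
  ∑ (allPairs v) (uncurry′ f)
    ≡⟨ ∑-filter (λ p → proj₁ p <? proj₂ p) (concatMap row (allFin v)) (uncurry′ f) ⟩
  ∑ (concatMap row (allFin v)) g
    ≡⟨ ∑-concatMap row (allFin v) g ⟩
  ∑[ x ∈ allFin v ] ∑ (row x) g
    ≡⟨ ∑-cong (allFin v) (λ x → ∑-map (x ,_) (allFin v) g) ⟩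
  ∑[ x ∈ allFin v ] ∑[ y ∈ allFin v ] ⟦ does (x <? y) ⟧ * f x y
    ∎
  where
  row : Fin v → List (Fin v × Fin v)
  row x = map (x ,_) (allFin v)
  g : Fin v × Fin v → ℕ
  g p = ⟦ does (proj₁ p <? proj₂ p) ⟧ * uncurry′ f p

∑-allPairs-point : ∀ {v} (p q : Fin v) →
                   ∑ (allPairs v) (uncurry′ λ x y → ⟦ x == p ∧ y == q ⟧) ≡ ⟦ does (p <? q) ⟧
∑-allPairs-point {v} p q = begin
  ∑ (allPairs v) (uncurry′ λ x y → ⟦ x == p ∧ y == q ⟧)
    ≡⟨ ∑-allPairs (λ x y → ⟦ x == p ∧ y == q ⟧) ⟩
  ∑[ x ∈ allFin v ] ∑[ y ∈ allFin v ] ⟦ does (x <? y) ⟧ * ⟦ x == p ∧ y == q ⟧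
    ≡⟨ ∑-cong (allFin v) (λ x → ∑-cong (allFin v) (λ y → rearrange x y)) ⟩
  ∑[ x ∈ allFin v ] ∑[ y ∈ allFin v ] ⟦ y == q ⟧ * (⟦ x == p ⟧ * ⟦ does (x <? y) ⟧)
    ≡⟨ ∑-cong (allFin v) (λ x → ∑-delta q (λ y → ⟦ x == p ⟧ * ⟦ does (x <? y) ⟧)) ⟩
  ∑[ x ∈ allFin v ] ⟦ x == p ⟧ * ⟦ does (x <? q) ⟧
    ≡⟨ ∑-delta p (λ x → ⟦ does (x <? q) ⟧) ⟩
  ⟦ does (p <? q) ⟧
    ∎
  where
  rearrange : ∀ x y → ⟦ does (x <? y) ⟧ * ⟦ x == p ∧ y == q ⟧ ≡ ⟦ y == q ⟧ * (⟦ x == p ⟧ * ⟦ does (x <? y) ⟧)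
  rearrange x y = trans (cong (⟦ does (x <? y) ⟧ *_) (⟦∧⟧ (x == p) (y == q)))
                        (reverse ⟦ does (x <? y) ⟧ ⟦ x == p ⟧ ⟦ y == q ⟧)
    where
    reverse : ∀ l s t → l * (s * t) ≡ t * (s * l)
    reverse = solve-∀

samePair⇒fst : ∀ {n} {x y p q : Fin n} → T (samePair x y p q) → T (x == p) ⊎ T (x == q)
samePair⇒fst {x = x} {y} {p} {q} same with to (T-∨ {x == p ∧ y == q}) same
... | inj₁ xp∧yq = inj₁ (proj₁ (to (T-∧ {x == p}) xp∧yq))
... | inj₂ xq∧yp = inj₂ (proj₁ (to (T-∧ {x == q}) xq∧yp))

∑-⟦samePair⟧ : ∀ {v} {p q : Fin v} → ¬ p ≡ q → ∑ (allPairs v) (uncurry′ λ x y → ⟦ samePair x y p q ⟧) ≡ 1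
∑-⟦samePair⟧ {v} {p} {q} p≢q = begin
  ∑ (allPairs v) (uncurry′ λ x y → ⟦ samePair x y p q ⟧)
    ≡⟨ ∑-⟦∨⟧ (uncurry′ λ x y → x == p ∧ y == q) (uncurry′ λ x y → x == q ∧ y == p) (allPairs v) disjoint ⟩
  ∑ (allPairs v) (uncurry′ λ x y → ⟦ x == p ∧ y == q ⟧) + ∑ (allPairs v) (uncurry′ λ x y → ⟦ x == q ∧ y == p ⟧)
    ≡⟨ cong₂ _+_ (∑-allPairs-point p q) (∑-allPairs-point q p) ⟩
  ⟦ does (p <? q) ⟧ + ⟦ does (q <? p) ⟧
    ≡⟨ ⟦p<q⟧+⟦q<p⟧≡1 p≢q ⟩
  1 ∎
  where
  disjoint : ∀ e → T (proj₁ e == p ∧ proj₂ e == q) → T (proj₁ e == q ∧ proj₂ e == p) → ⊥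
  disjoint (x , y) xp∧yq xq∧yp =
    ==-apart p≢q (proj₁ (to (T-∧ {x == p}) xp∧yq)) (proj₁ (to (T-∧ {x == q}) xq∧yp))

∑-⟦pairIn⟧ : ∀ {v} (B : NBlock v) → ∑[ e ∈ allPairs v ] ⟦ uncurry′ pairIn e B ⟧ ≡ 2
∑-⟦pairIn⟧ {v} B =
  trans (∑-⟦∨⟧ (uncurry′ λ x y → samePair x y (a B) (b B)) (uncurry′ λ x y → samePair x y (c B) (d B))
               (allPairs v) disjoint)
        (cong₂ _+_ (∑-⟦samePair⟧ (a≢b B)) (∑-⟦samePair⟧ (c≢d B)))
  where
  disjoint : ∀ e → T (samePair (proj₁ e) (proj₂ e) (a B) (b B)) → T (samePair (proj₁ e) (proj₂ e) (c B) (d B)) → ⊥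
  disjoint (x , y) ab cd with samePair⇒fst {x = x} {y} ab | samePair⇒fst {x = x} {y} cd
  ... | inj₁ x≡a | inj₁ x≡c = ==-apart (a≢c B) x≡a x≡c
  ... | inj₁ x≡a | inj₂ x≡d = ==-apart (a≢d B) x≡a x≡d
  ... | inj₂ x≡b | inj₁ x≡c = ==-apart (b≢c B) x≡b x≡c
  ... | inj₂ x≡b | inj₂ x≡d = ==-apart (b≢d B) x≡b x≡d

∑-⟦∈B⟧ : ∀ {v} (B : NBlock v) → ∑[ x ∈ allFin v ] ⟦ x ∈B B ⟧ ≡ 4
∑-⟦∈B⟧ {v} B = begin
  count (_∈B B)
    ≡⟨ ∑-⟦∨⟧ (_== a B) (λ x → x == b B ∨ x == c B ∨ x == d B) (allFin v) a-apart ⟩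
  count (_== a B) + count (λ x → x == b B ∨ x == c B ∨ x == d B)
    ≡⟨ cong (count (_== a B) +_) (∑-⟦∨⟧ (_== b B) (λ x → x == c B ∨ x == d B) (allFin v) b-apart) ⟩
  count (_== a B) + (count (_== b B) + count (λ x → x == c B ∨ x == d B))
    ≡⟨ cong (λ s → count (_== a B) + (count (_== b B) + s)) (∑-⟦∨⟧ (_== c B) (_== d B) (allFin v) c-apart) ⟩
  count (_== a B) + (count (_== b B) + (count (_== c B) + count (_== d B)))
    ≡⟨ cong₂ _+_ (∑-⟦==⟧ (a B)) (cong₂ _+_ (∑-⟦==⟧ (b B)) (cong₂ _+_ (∑-⟦==⟧ (c B)) (∑-⟦==⟧ (d B)))) ⟩
  4 ∎
  where
  count : (Fin v → Bool) → ℕ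
  count P = ∑[ x ∈ allFin v ] ⟦ P x ⟧
  ∨-apart : ∀ {s t} → (T s → ⊥) → (T t → ⊥) → T (s ∨ t) → ⊥
  ∨-apart {s} ¬s ¬t = [ ¬s , ¬t ] ∘ to (T-∨ {s})
  c-apart : ∀ x → T (x == c B) → T (x == d B) → ⊥
  c-apart x = ==-apart (c≢d B)
  b-apart : ∀ x → T (x == b B) → T (x == c B ∨ x == d B) → ⊥
  b-apart x x≡b = ∨-apart (==-apart (b≢c B) x≡b) (==-apart (b≢d B) x≡b)
  a-apart : ∀ x → T (x == a B) → T (x == b B ∨ x == c B ∨ x == d B) → ⊥
  a-apart x x≡a = ∨-apart (==-apart (a≢b B) x≡a) (∨-apart (==-apart (a≢c B) x≡a) (==-apart (a≢d B) x≡a))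

∑-tripleCount≡C3 : ∀ {v} (𝓑 : List (NBlock v)) →
                   (∀ (x y z : Fin v) → x < y → y < z → tripleCount 𝓑 x y z ≡ 1) →
                   ∑ (triples (allFin v)) (uncurry₃ (tripleCount 𝓑)) ≡ v C 3
∑-tripleCount≡C3 {v} 𝓑 once = begin
  ∑ (triples (allFin v)) (uncurry₃ (tripleCount 𝓑))
    ≡⟨ ∑-cong-All (All.map (λ { {x , y , z} (x<y , y<z) → once x y z x<y y<z }) (triples⁺ (allFin-sorted v))) ⟩
  ∑[ _ ∈ triples (allFin v) ] 1
    ≡⟨ ∑-triples-∧ (λ _ → true) (allFin v) ⟩
  (∑[ _ ∈ allFin v ] 1) C 3
    ≡⟨ cong (_C 3) (trans (∑-1 (allFin v)) (length-tabulate {n = v} id)) ⟩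
  v C 3 ∎

∑-tripleCount≡4*length : ∀ {v} (𝓑 : List (NBlock v)) →
                         ∑ (triples (allFin v)) (uncurry₃ (tripleCount 𝓑)) ≡ 4 * length 𝓑
∑-tripleCount≡4*length {v} 𝓑 = begin
  ∑ (triples (allFin v)) (uncurry₃ (tripleCount 𝓑))
    ≡⟨ double-counting (λ t B → uncurry₃ tripleIn t B) (triples (allFin v)) 𝓑 ⟩
  ∑[ B ∈ 𝓑 ] ∑[ t ∈ triples (allFin v) ] ⟦ uncurry₃ tripleIn t B ⟧
    ≡⟨ ∑-cong 𝓑 (λ B → trans (∑-triples-∧ (_∈B B) (allFin v)) (cong (_C 3) (∑-⟦∈B⟧ B))) ⟩
  ∑[ _ ∈ 𝓑 ] 4
    ≡⟨ ∑-const 4 𝓑 ⟩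
  4 * length 𝓑 ∎

∑-multiplicity≡2*length : ∀ {v} (𝓑 : List (NBlock v)) →
                          ∑ (allPairs v) (uncurry′ (multiplicity 𝓑)) ≡ 2 * length 𝓑
∑-multiplicity≡2*length {v} 𝓑 = begin
  ∑ (allPairs v) (uncurry′ (multiplicity 𝓑))
    ≡⟨ double-counting (λ e B → uncurry′ pairIn e B) (allPairs v) 𝓑 ⟩
  ∑[ B ∈ 𝓑 ] ∑[ e ∈ allPairs v ] ⟦ uncurry′ pairIn e B ⟧
    ≡⟨ ∑-cong 𝓑 ∑-⟦pairIn⟧ ⟩
  ∑[ _ ∈ 𝓑 ] 2
    ≡⟨ ∑-const 2 𝓑 ⟩
  2 * length 𝓑 ∎

∑-multiplicity≡m*numNDPairs : ∀ {v} (𝓑 : List (NBlock v)) m →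
                              (∀ x y → IsNDPair 𝓑 x y → multiplicity 𝓑 x y ≡ m) →
                              ∑ (allPairs v) (uncurry′ (multiplicity 𝓑)) ≡ m * numNDPairs 𝓑
∑-multiplicity≡m*numNDPairs {v} 𝓑 m uniform =
  ∑-uniform-on-support (uncurry′ (multiplicity 𝓑)) m (allPairs v)
    (All.map (λ { {x , y} x<y → curry (uniform x y) x<y })
             (all-filter (λ e → proj₁ e <? proj₂ e) (concatMap (λ x → map (x ,_) (allFin v)) (allFin v))))

data EvenOrOdd : ℕ → Set where
  even : ∀ k → EvenOrOdd (k * 2)
  odd  : ∀ k → EvenOrOdd (suc (k * 2))

evenOrOdd : ∀ n → EvenOrOdd n
evenOrOdd zero = even 0
evenOrOdd (suc n) with evenOrOdd n
... | even k = odd k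
... | odd  k = even (suc k)

k*2≢1+l*2 : ∀ k l → k * 2 ≢ suc (l * 2)
k*2≢1+l*2 k l eq = even≢odd k l (trans (*-comm 2 k) (trans eq (cong suc (*-comm l 2))))

[1+k*2]/2≡k : ∀ k → suc (k * 2) / 2 ≡ k
[1+k*2]/2≡k k = trans (+-distrib-/-∣ʳ 1 {d = 2} (divides-refl k)) (m*n/n≡m k 2)

[1+n]C2*2≡[1+n]*n : ∀ n → (suc n C 2) * 2 ≡ suc n * n
[1+n]C2*2≡[1+n]*n zero    = refl
[1+n]C2*2≡[1+n]*n (suc n) = begin
  (suc (suc n) C 2) * 2          ≡⟨ cong (_* 2) (nCk+nC[k+1]≡[n+1]C[k+1] (suc n) 1) ⟨
  (suc n C 1 + suc n C 2) * 2    ≡⟨ cong (λ s → (s + suc n C 2) * 2) (nC1≡n (suc n)) ⟩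
  (suc n + suc n C 2) * 2        ≡⟨ *-distribʳ-+ 2 (suc n) (suc n C 2) ⟩
  suc n * 2 + (suc n C 2) * 2    ≡⟨ cong (suc n * 2 +_) ([1+n]C2*2≡[1+n]*n n) ⟩
  suc n * 2 + suc n * n          ≡⟨ *-distribˡ-+ (suc n) 2 n ⟨
  suc n * suc (suc n)            ≡⟨ *-comm (suc n) (suc (suc n)) ⟩
  suc (suc n) * suc n            ∎

[2+n]C3*6≡[2+n][1+n]n : ∀ n → (suc (suc n) C 3) * 6 ≡ suc (suc n) * suc n * n
[2+n]C3*6≡[2+n][1+n]n zero    = refl
[2+n]C3*6≡[2+n][1+n]n (suc n) = begin
  (suc (suc (suc n)) C 3) * 6
    ≡⟨ cong (_* 6) (nCk+nC[k+1]≡[n+1]C[k+1] (suc (suc n)) 2) ⟨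
  (suc (suc n) C 2 + suc (suc n) C 3) * 6
    ≡⟨ *-distribʳ-+ 6 (suc (suc n) C 2) _ ⟩
  (suc (suc n) C 2) * 6 + (suc (suc n) C 3) * 6
    ≡⟨ cong (_+ (suc (suc n) C 3) * 6) (*-assoc (suc (suc n) C 2) 2 3) ⟨
  (suc (suc n) C 2) * 2 * 3 + (suc (suc n) C 3) * 6
    ≡⟨ cong₂ (λ s t → s * 3 + t) ([1+n]C2*2≡[1+n]*n (suc n)) ([2+n]C3*6≡[2+n][1+n]n n) ⟩
  suc (suc n) * suc n * 3 + suc (suc n) * suc n * n
    ≡⟨ factor n ⟩
  suc (suc (suc n)) * suc (suc n) * suc n
    ∎
  where
  factor : ∀ n → suc (suc n) * suc n * 3 + suc (suc n) * suc n * n ≡ suc (suc (suc n)) * suc (suc n) * suc n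
  factor = solve-∀

odd-order-impossible : ∀ j m → (suc (suc (suc j) * 2) C 3) ≢ 2 * (m * (suc (suc j) * suc j))
odd-order-impossible j m eq =
  -- (2j+5)(2j+3) = 2(2j²+8j+7)+1 is odd, while 6m(j+1) is even
  k*2≢1+l*2 (m * suc j * 3) (j * j * 2 + j * 8 + 7) (sym (*-cancelˡ-≡ _ _ (suc (suc j) * 2) (begin
    suc (suc j) * 2 * suc ((j * j * 2 + j * 8 + 7) * 2) ≡⟨ expand j ⟩
    (5 + j * 2) * (4 + j * 2) * (3 + j * 2)             ≡⟨ [2+n]C3*6≡[2+n][1+n]n (3 + j * 2) ⟨
    (suc (suc (suc j) * 2) C 3) * 6                     ≡⟨ cong (_* 6) eq ⟩
    2 * (m * (suc (suc j) * suc j)) * 6                 ≡⟨ regroup j m ⟩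
    suc (suc j) * 2 * (m * suc j * 3 * 2)               ∎)))
  where
  expand : ∀ j → suc (suc j) * 2 * suc ((j * j * 2 + j * 8 + 7) * 2) ≡ (5 + j * 2) * (4 + j * 2) * (3 + j * 2)
  expand = solve-∀
  regroup : ∀ j m → 2 * (m * (suc (suc j) * suc j)) * 6 ≡ suc (suc j) * 2 * (m * suc j * 3 * 2)
  regroup = solve-∀

even-order⇒3m≡v∸1 : ∀ j m → ((suc (suc j) * 2) C 3) ≡ 2 * (m * (suc (suc j) * suc j)) → 3 + j * 2 ≡ m * 3
even-order⇒3m≡v∸1 j m eq = *-cancelˡ-≡ _ _ (suc (suc j) * suc j * 4) (begin
  suc (suc j) * suc j * 4 * (3 + j * 2)   ≡⟨ expand j ⟩
  (4 + j * 2) * (3 + j * 2) * (2 + j * 2) ≡⟨ [2+n]C3*6≡[2+n][1+n]n (2 + j * 2) ⟨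
  ((suc (suc j) * 2) C 3) * 6             ≡⟨ cong (_* 6) eq ⟩
  2 * (m * (suc (suc j) * suc j)) * 6     ≡⟨ regroup j m ⟩
  suc (suc j) * suc j * 4 * (m * 3)       ∎)
  where
  expand : ∀ j → suc (suc j) * suc j * 4 * (3 + j * 2) ≡ (4 + j * 2) * (3 + j * 2) * (2 + j * 2)
  expand = solve-∀
  regroup : ∀ j m → 2 * (m * (suc (suc j) * suc j)) * 6 ≡ suc (suc j) * suc j * 4 * (m * 3)
  regroup = solve-∀

3m≡v∸1⇒v%6≡4 : ∀ j m → 3 + j * 2 ≡ m * 3 → (4 + j * 2) % 6 ≡ 4
3m≡v∸1⇒v%6≡4 j m eq with evenOrOdd m
... | even i = ⊥-elim (k*2≢1+l*2 (i * 3) (suc j) (sym (trans eq (swap i))))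
  where
  swap : ∀ i → i * 2 * 3 ≡ i * 3 * 2
  swap = solve-∀
... | odd  i = trans (cong (_% 6) (trans (cong suc eq) (reshape i))) ([m+kn]%n≡m%n 4 i 6)
  where
  reshape : ∀ i → suc (suc (i * 2) * 3) ≡ 4 + i * 6
  reshape = solve-∀

incidences⇒v%6≡4×m≡[v∸1]/3 : ∀ v m → 4 ≤ v → v C 3 ≡ 2 * (m * (v / 2 * (v / 2 ∸ 1))) →
                              v % 6 ≡ 4 × m ≡ (v ∸ 1) / 3
incidences⇒v%6≡4×m≡[v∸1]/3 v m 4≤v eq with evenOrOdd v | 4≤v
... | even 0 | ()
... | even 1 | s≤s (s≤s ())
... | odd  0 | s≤s ()
... | odd  1 | s≤s (s≤s (s≤s ()))
... | even k@(suc (suc j)) | _ = 3m≡v∸1⇒v%6≡4 j m 3m≡v∸1 , sym (trans (cong (_/ 3) 3m≡v∸1) (m*n/n≡m m 3))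
  where
  3m≡v∸1 : 3 + j * 2 ≡ m * 3
  3m≡v∸1 = even-order⇒3m≡v∸1 j m (trans eq (cong (λ h → 2 * (m * (h * (h ∸ 1)))) (m*n/n≡m k 2)))
... | odd  k@(suc (suc j)) | _ =
  ⊥-elim (odd-order-impossible j m (trans eq (cong (λ h → 2 * (m * (h * (h ∸ 1)))) ([1+k*2]/2≡k k))))

theorem4p3 : (v : ℕ) (𝓑 : List (NBlock v)) →
    IsNestedSQS v 𝓑 →
    IsUniform 𝓑 →
    numNDPairs 𝓑 ≡ (v / 2) * ((v / 2) ∸ 1) →
    (v % 6 ≡ 4) ×
    (∀ (x y : Fin v) → IsNDPair 𝓑 x y → multiplicity 𝓑 x y ≡ (v ∸ 1) / 3)
theorem4p3 v 𝓑 (4≤v , once) (m , uniform) #ND≡ =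
  let v%6≡4 , m≡[v∸1]/3 = incidences⇒v%6≡4×m≡[v∸1]/3 v m 4≤v incidences
  in  v%6≡4 , λ x y nd → trans (uniform x y nd) m≡[v∸1]/3
  where
  incidences : v C 3 ≡ 2 * (m * (v / 2 * (v / 2 ∸ 1)))
  incidences = begin
    v C 3                                              ≡⟨ ∑-tripleCount≡C3 𝓑 once ⟨
    ∑ (triples (allFin v)) (uncurry₃ (tripleCount 𝓑))  ≡⟨ ∑-tripleCount≡4*length 𝓑 ⟩
    4 * length 𝓑                                       ≡⟨ *-assoc 2 2 (length 𝓑) ⟩
    2 * (2 * length 𝓑)                                 ≡⟨ cong (2 *_) (∑-multiplicity≡2*length 𝓑) ⟨
    2 * ∑ (allPairs v) (uncurry′ (multiplicity 𝓑))     ≡⟨ cong (2 *_) (∑-multiplicity≡m*numNDPairs 𝓑 m uniform) ⟩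
    2 * (m * numNDPairs 𝓑)                             ≡⟨ cong (λ N → 2 * (m * N)) #ND≡ ⟩
    2 * (m * (v / 2 * (v / 2 ∸ 1)))                    ∎
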